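{- Let $L\ge2$ and $n\ge2$ be integers, and let $t$, $g$ be integers with $0\le t\le n-1$ and $1\le g\le L-1$. Then for every integer $m$ with $gL^t\le m\le\lfloor L^n/2\rfloor$, $\xi_m(K_L^n)\ge\xi_{gL^t}(K_L^n)$.
   Context: $K_L^n$ is the graph on strings $x_n\cdots x_1$ over $\{0,\dots,L-1\}$, adjacent iff they differ in exactly one coordinate. For an integer $0\le m\le L^n$ with base-$L$ expansion $m=\sum_{i=0}^{s}a_iL^{b_i}$ ($a_i\in\{1,\dots,L-1\}$, $b_0>\dots>b_s\ge0$) let $ex_m(K_L^n)=\sum_{i=0}^{s}[(L-1)a_ib_iL^{b_i}+(a_i-1)a_iL^{b_i}]+2\sum_{i=0}^{s-1}\sum_{k=i+1}^{s}a_ia_kL^{b_k}$ ($ex_0=0$), and $\xi_m(K_L^n)=(L-1)nm-ex_m(K_L^n)$. -}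

module Defs where

open import Data.Nat using (ℕ; zero; suc; _+_; _*_; _∸_; _^_; _/_; _%_; _<ᵇ_)
open import Data.Bool using (if_then_else_)
open import Data.Integer as ℤ using (ℤ; +_; _-_)

sumBelow : ℕ → (ℕ → ℕ) → ℕ
sumBelow zero    f = 0
sumBelow (suc N) f = sumBelow N f + f N

-- ⌊ m / L^j ⌋ (defined for L ≥ 1; junk value 0 for L = 0)
shiftDown : ℕ → ℕ → ℕ → ℕ
shiftDown zero    m j       = 0
shiftDown (suc l) m zero    = m
shiftDown (suc l) m (suc j) = shiftDown (suc l) m j / suc l

digit : ℕ → ℕ → ℕ → ℕ
digit zero    m j = 0
digit (suc l) m j = shiftDown (suc l) m j % suc l

higherDigitSum : ℕ → ℕ → ℕ → ℕ → ℕ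
higherDigitSum L m N j = sumBelow N (λ p → if j <ᵇ p then digit L m p else 0)

-- ex_m(K_L^n), following the paper's formula with m = Σ_i a_i L^{b_i}.
-- We sum over all digit positions j < m+1 (for L ≥ 2 every nonzero digit
-- of m lies at a position ≤ m); positions with digit 0 contribute 0.
-- For the pair term: Σ_{i<k} a_i a_k L^{b_k} (b_i > b_k) is, indexed by the
-- lower position j = b_k, Σ_j d_j L^j (Σ_{p > j} d_p).
ex : ℕ → ℕ → ℕ
ex L m = sumBelow (suc m) term
  where
  term : ℕ → ℕ
  term j = (L ∸ 1) * digit L m j * j * L ^ j
         + (digit L m j ∸ 1) * digit L m j * L ^ j
         + 2 * (digit L m j * higherDigitSum L m (suc m) j * L ^ j)

ξ : ℕ → ℕ → ℕ → ℤ
ξ L n m = + ((L ∸ 1) * n * m) - + ex L m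

{-# OPTIONS --safe #-}
-- Let l = L - 1. Unfolding the digit formula for ex at the leading digit q of m = q L^j + r
-- (r < L^j) gives ex m = l q j L^j + (q - 1) q L^j + 2 q r + ex r, and by induction
-- ex r ≤ l j r. Hence, for n = j + 1 + s and C = l s + L, ξ_n(m) ≥ L^j q (C - q) provided
-- 2 q r ≤ l (s + 1) r, which holds when s > 0 and, for s = 0, is forced by m ≤ L^n / 2;
-- for m = g L^j the bound is an equality. Now let a = g L^t ≤ m, so t ≤ j. If t = j the
-- claim is the monotonicity of x ↦ x (C - x) on x ≤ C / 2. If t < j, then
-- ξ_n(a) ≤ l (s + 1) L^j (each unit of n or j adds only l a ≤ l L^j), while
-- q (C - q) ≥ C - 1 = l (s + 1).
module Submission where

open import Defs
open import Data.Nat using (ℕ; _*_; _^_; _/_; _≤_; _<_)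
open import Data.Integer as ℤ using ()
import Data.Integer.Properties as ℤ
open import Data.Nat
open import Data.Nat.Properties
open import Data.Nat.DivMod
open import Data.Nat.Divisibility using (divides-refl)
open import Data.Nat.Tactic.RingSolver using (solve-∀)
open import Algebra.Properties.CommutativeSemigroup +-commutativeSemigroup using ()
  renaming (x∙yz≈y∙xz to m+[n+o]≡n+[m+o])
open import Algebra.Properties.CommutativeSemigroup *-commutativeSemigroup using ()
  renaming (x∙yz≈y∙xz to m*[n*o]≡n*[m*o])
open import Data.Bool using (true; false; if_then_else_)
open import Data.Sum using (inj₁; inj₂)
open import Data.Product using (_×_; _,_; proj₁; proj₂)
open import Relation.Binary.PropositionalEquality
open import Relation.Nullary using (yes; no; contradiction)

sumBelow-shift : ∀ N f → sumBelow (suc N) f ≡ f 0 + sumBelow N (λ j → f (suc j))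
sumBelow-shift zero    f = sym (+-identityʳ (f 0))
sumBelow-shift (suc N) f rewrite sumBelow-shift N f = +-assoc (f 0) _ _

sumBelow-cong : ∀ N {f g} → (∀ j → j < N → f j ≡ g j) → sumBelow N f ≡ sumBelow N g
sumBelow-cong zero    eq = refl
sumBelow-cong (suc N) eq = cong₂ _+_ (sumBelow-cong N (λ j j<N → eq j (m<n⇒m<1+n j<N))) (eq N ≤-refl)

sumBelow-distrib-+ : ∀ N f g → sumBelow N (λ j → f j + g j) ≡ sumBelow N f + sumBelow N g
sumBelow-distrib-+ zero    f g = refl
sumBelow-distrib-+ (suc N) f g rewrite sumBelow-distrib-+ N f g = swap (sumBelow N f) (sumBelow N g) (f N) (g N)
  where
  swap : ∀ a b c d → a + b + (c + d) ≡ a + c + (b + d)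
  swap = solve-∀

sumBelow-*ˡ : ∀ N c f → sumBelow N (λ j → c * f j) ≡ c * sumBelow N f
sumBelow-*ˡ zero    c f = sym (*-zeroʳ c)
sumBelow-*ˡ (suc N) c f rewrite sumBelow-*ˡ N c f = sym (*-distribˡ-+ c _ _)

sumBelow-vanishing : ∀ B f → (∀ j → B ≤ j → f j ≡ 0) → ∀ N → B ≤ N → sumBelow N f ≡ sumBelow B f
sumBelow-vanishing B f vanish N B≤N with m≤n⇒m<n∨m≡n B≤N
... | inj₂ refl = refl
sumBelow-vanishing B f vanish (suc N) _ | inj₁ (s≤s B≤N) =
  trans (cong (sumBelow N f +_) (vanish N B≤N))
        (trans (+-identityʳ _) (sumBelow-vanishing B f vanish N B≤N))

≤-offset : ∀ {m n} k → m + k ≡ n → m ≤ n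
≤-offset {m} k eq = subst (m ≤_) eq (m≤m+n m k)

+-exchange-≤ : ∀ {x y z u v} → x ≤ y + z → z + u ≤ v → x + u ≤ y + v
+-exchange-≤ {x} {y} {z} {u} {v} x≤y+z z+u≤v = begin
  x + u       ≤⟨ +-monoˡ-≤ u x≤y+z ⟩
  y + z + u   ≡⟨ +-assoc y z u ⟩
  y + (z + u) ≤⟨ +-monoʳ-≤ y z+u≤v ⟩
  y + v       ∎
  where open ≤-Reasoning

m<n⇐2m≤n : ∀ {m n} → 1 ≤ m → 2 * m ≤ n → m < n
m<n⇐2m≤n {m} {n} 1≤m 2m≤n = ≤-trans (m<m+n m 1≤m) (subst (_≤ n) (cong (m +_) (+-identityʳ m)) 2m≤n)

m≤n/2⇒2m≤n : ∀ m n → m ≤ n / 2 → 2 * m ≤ n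
m≤n/2⇒2m≤n m n m≤n/2 = subst (_≤ n) (*-comm m 2) (≤-trans (*-monoˡ-≤ 2 m≤n/2) (m/n*n≤m n 2))

m*[n∸m]-mono : ∀ C g q → g ≤ q → q + q ≤ C → g * (C ∸ g) ≤ q * (C ∸ q)
m*[n∸m]-mono C g q g≤q q+q≤C with m≤n⇒∃[o]m+o≡n g≤q | m≤n⇒∃[o]m+o≡n q+q≤C
m*[n∸m]-mono .(g + d + (g + d) + e) g .(g + d) _ _ | d , refl | e , refl =
  ≤-offset (d * d + d * e) (begin
    g * (C ∸ g) + (d * d + d * e)             ≡⟨ cong (λ x → g * x + (d * d + d * e)) (∸-left {g} C≡g+) ⟩
    g * (g + 2 * d + e) + (d * d + d * e)     ≡⟨ expand g d e ⟩
    (g + d) * (g + d + e)                     ≡⟨ cong ((g + d) *_) (sym (∸-left {g + d} C≡q+)) ⟩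
    (g + d) * (C ∸ (g + d))                   ∎)
  where
  open ≡-Reasoning
  C : ℕ
  C = g + d + (g + d) + e
  ∸-left : ∀ {x y} → C ≡ x + y → C ∸ x ≡ y
  ∸-left {x} {y} eq = trans (cong (_∸ x) eq) (m+n∸m≡n x y)
  C≡g+ : C ≡ g + (g + 2 * d + e)
  C≡g+ = reorder g d e
    where
    reorder : ∀ g d e → g + d + (g + d) + e ≡ g + (g + 2 * d + e)
    reorder = solve-∀
  C≡q+ : C ≡ g + d + (g + d + e)
  C≡q+ = +-assoc (g + d) (g + d) e
  expand : ∀ g d e → g * (g + 2 * d + e) + (d * d + d * e) ≡ (g + d) * (g + d + e)
  expand = solve-∀

n∸1≤m*[n∸m] : ∀ C q → 1 ≤ q → q < C → C ∸ 1 ≤ q * (C ∸ q)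
n∸1≤m*[n∸m] C (suc p) _ q<C with m≤n⇒∃[o]m+o≡n q<C
n∸1≤m*[n∸m] .(suc (suc p) + u) (suc p) _ _ | u , refl =
  ≤-offset (p * u) (begin
    suc p + u + p * u               ≡⟨ expand p u ⟩
    suc p * suc u                   ≡⟨ cong (suc p *_) (sym (m+n∸m≡n (suc p) (suc u))) ⟩
    suc p * (suc p + suc u ∸ suc p) ≡⟨ cong (λ x → suc p * (x ∸ suc p)) (+-suc (suc p) u) ⟩
    suc p * (suc (suc p) + u ∸ suc p) ∎)
  where
  open ≡-Reasoning
  expand : ∀ p u → suc p + u + p * u ≡ suc p * suc u
  expand = solve-∀

factor-step-≤ : ∀ l n a e B b → l * suc n * a ≤ e + B → a ≤ b → l * suc (suc n) * a ≤ e + (B + l * b)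
factor-step-≤ l n a e B b bound a≤b = begin
  l * suc (suc n) * a ≡⟨ split l n a ⟩
  l * suc n * a + l * a ≤⟨ +-mono-≤ bound (*-monoʳ-≤ l a≤b) ⟩
  e + B + l * b         ≡⟨ +-assoc e B (l * b) ⟩
  e + (B + l * b)       ∎
  where
  open ≤-Reasoning
  split : ∀ l n a → l * suc (suc n) * a ≡ l * suc n * a + l * a
  split = solve-∀

data QuotRem (D B : ℕ) : ℕ → Set where
  quotRem : ∀ q r → q < B → r < D → QuotRem D B (q * D + r)

quotRem? : ∀ D B m .{{_ : NonZero D}} → m < B * D → QuotRem D B m
quotRem? D B m m<BD = subst (QuotRem D B) (sym m≡) (quotRem (m / D) (m % D) (m<n*o⇒m/o<n m<BD) (m%n<n m D))
  where
  m≡ : m ≡ m / D * D + m % D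
  m≡ = trans (m≡m%n+[m/n]*n m D) (+-comm (m % D) _)

ex≤-arith : ∀ l k q M r → q ≤ l → r ≤ M →
  l * q * k * M + (q ∸ 1) * q * M + 2 * q * r + l * k * r ≤ l * suc k * (q * M + r)
ex≤-arith l k q M r q≤l r≤M with m≤n⇒∃[o]m+o≡n q≤l | m≤n⇒∃[o]m+o≡n r≤M
ex≤-arith .(0 + e) k zero .(r + f) r _ _ | e , refl | f , refl =
  ≤-offset (e * r) (expand k r e f)
  where
  expand : ∀ k r e f → (0 + e) * 0 * k * (r + f) + 0 * 0 * (r + f) + 2 * 0 * r + (0 + e) * k * r + e * r
                     ≡ (0 + e) * suc k * (0 * (r + f) + r)
  expand = solve-∀
ex≤-arith .(suc p + e) k (suc p) .(r + f) r _ _ | e , refl | f , refl =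
  ≤-offset (suc p * r * e + suc p * f * (1 + e) + r * e) (expand k p r e f)
  where
  expand : ∀ k p r e f →
    (suc p + e) * suc p * k * (r + f) + p * suc p * (r + f) + 2 * suc p * r + (suc p + e) * k * r
      + (suc p * r * e + suc p * f * (1 + e) + r * e)
      ≡ (suc p + e) * suc k * (suc p * (r + f) + r)
  expand = solve-∀

ξ-single-arith : ∀ l s t g P → g ≤ suc l →
  l * g * t * P + (g ∸ 1) * g * P + P * (g * (l * s + suc l ∸ g)) ≡ l * suc (s + t) * (g * P)
ξ-single-arith l s t zero    P _ = expand l s t P
  where
  expand : ∀ l s t P → l * 0 * t * P + 0 * 0 * P + P * (0 * (l * s + suc l)) ≡ l * suc (s + t) * (0 * P)
  expand = solve-∀
ξ-single-arith l s t (suc p) P (s≤s p≤l) with m≤n⇒∃[o]m+o≡n p≤l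
ξ-single-arith .(p + w) s t (suc p) P _ | w , refl = begin
  (p + w) * suc p * t * P + p * suc p * P + P * (suc p * ((p + w) * s + suc (p + w) ∸ suc p))
    ≡⟨ cong (λ x → (p + w) * suc p * t * P + p * suc p * P + P * (suc p * x)) complement ⟩
  (p + w) * suc p * t * P + p * suc p * P + P * (suc p * ((p + w) * s + w))
    ≡⟨ expand p w s t P ⟩
  (p + w) * suc (s + t) * (suc p * P) ∎
  where
  open ≡-Reasoning
  complement : (p + w) * s + suc (p + w) ∸ suc p ≡ (p + w) * s + w
  complement = trans (cong (_∸ suc p) (reorder p w s)) (m+n∸m≡n (suc p) ((p + w) * s + w))
    where
    reorder : ∀ p w s → (p + w) * s + suc (p + w) ≡ suc p + ((p + w) * s + w)
    reorder = solve-∀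
  expand : ∀ p w s t P →
    (p + w) * suc p * t * P + p * suc p * P + P * (suc p * ((p + w) * s + w)) ≡ (p + w) * suc (s + t) * (suc p * P)
  expand = solve-∀

ξ-leading-≥-arith : ∀ l s j q P r X → q ≤ l → X ≤ l * j * r → 2 * q * r ≤ l * suc s * r →
  P * (q * (l * s + suc l ∸ q)) + (l * q * j * P + (q ∸ 1) * q * P + 2 * q * r + X) ≤ l * suc (s + j) * (q * P + r)
ξ-leading-≥-arith l s j q P r X q≤l X≤ 2qr≤ =
  ≤-trans (+-monoʳ-≤ (P * (q * (l * s + suc l ∸ q))) (+-monoʳ-≤ (l * q * j * P + (q ∸ 1) * q * P + 2 * q * r) X≤))
          (+-cancelʳ-≤ (2 * q * r) _ _ (≤-trans (+-monoʳ-≤ _ 2qr≤) (≤-reflexive (exact l q q≤l))))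
  where
  exact : ∀ l q → q ≤ l →
    P * (q * (l * s + suc l ∸ q)) + (l * q * j * P + (q ∸ 1) * q * P + 2 * q * r + l * j * r) + l * suc s * r
      ≡ l * suc (s + j) * (q * P + r) + 2 * q * r
  exact l zero _ = expand l s j P r
    where
    expand : ∀ l s j P r →
      P * (0 * (l * s + suc l)) + (l * 0 * j * P + 0 * 0 * P + 2 * 0 * r + l * j * r) + l * suc s * r
        ≡ l * suc (s + j) * (0 * P + r) + 2 * 0 * r
    expand = solve-∀
  exact l (suc p) q≤l with m≤n⇒∃[o]m+o≡n q≤l
  exact .(suc p + w) (suc p) _ | w , refl = begin
    P * (suc p * ((suc p + w) * s + suc (suc p + w) ∸ suc p)) + rest + (suc p + w) * suc s * r
      ≡⟨ cong (λ x → P * (suc p * x) + rest + (suc p + w) * suc s * r) complement ⟩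
    P * (suc p * ((suc p + w) * s + suc w)) + rest + (suc p + w) * suc s * r
      ≡⟨ expand p w s j P r ⟩
    (suc p + w) * suc (s + j) * (suc p * P + r) + 2 * suc p * r ∎
    where
    open ≡-Reasoning
    rest : ℕ
    rest = (suc p + w) * suc p * j * P + p * suc p * P + 2 * suc p * r + (suc p + w) * j * r
    complement : (suc p + w) * s + suc (suc p + w) ∸ suc p ≡ (suc p + w) * s + suc w
    complement = trans (cong (_∸ suc p) (reorder p w s)) (m+n∸m≡n (suc p) ((suc p + w) * s + suc w))
      where
      reorder : ∀ p w s → (suc p + w) * s + suc (suc p + w) ≡ suc p + ((suc p + w) * s + suc w)
      reorder = solve-∀
    expand : ∀ p w s j P r →
      P * (suc p * ((suc p + w) * s + suc w))
        + ((suc p + w) * suc p * j * P + p * suc p * P + 2 * suc p * r + (suc p + w) * j * r)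
        + (suc p + w) * suc s * r
        ≡ (suc p + w) * suc (s + j) * (suc p * P + r) + 2 * suc p * r
    expand = solve-∀

module Radix (l : ℕ) (1≤l : 1 ≤ l) where

  L : ℕ
  L = suc l

  shiftDown-suc : ∀ m j → shiftDown L m (suc j) ≡ shiftDown L (m / L) j
  shiftDown-suc m zero    = refl
  shiftDown-suc m (suc j) = cong (_/ L) (shiftDown-suc m j)

  digit-suc : ∀ m j → digit L m (suc j) ≡ digit L (m / L) j
  digit-suc m j = cong (_% L) (shiftDown-suc m j)

  [xL+d]/L≡x : ∀ x d → d < L → (x * L + d) / L ≡ x
  [xL+d]/L≡x x d d<L = trans (+-distrib-/-∣ˡ d (divides-refl x))
    (trans (cong₂ _+_ (m*n/n≡m x L) (m<n⇒m/n≡0 d<L)) (+-identityʳ x))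

  digit-append-zero : ∀ x d → d < L → digit L (x * L + d) 0 ≡ d
  digit-append-zero x d d<L = trans (cong (_% L) (+-comm (x * L) d)) (trans ([m+kn]%n≡m%n d x L) (m<n⇒m%n≡m d<L))

  digit-append-suc : ∀ x d → d < L → ∀ j → digit L (x * L + d) (suc j) ≡ digit L x j
  digit-append-suc x d d<L j = trans (digit-suc (x * L + d) j) (cong (λ y → digit L y j) ([xL+d]/L≡x x d d<L))

  shiftDown-vanish : ∀ m p → m ≤ p → shiftDown L m p ≡ 0
  shiftDown-vanish zero    zero    _   = refl
  shiftDown-vanish zero    (suc p) _   = trans (shiftDown-suc 0 p) (shiftDown-vanish 0 p z≤n)
  shiftDown-vanish (suc m) (suc p) m≤p = trans (shiftDown-suc (suc m) p)
    (shiftDown-vanish (suc m / L) p (≤-pred (≤-trans (m/n<m (suc m) L (s≤s 1≤l)) m≤p)))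

  digit-vanish : ∀ m p → m ≤ p → digit L m p ≡ 0
  digit-vanish m p m≤p = cong (_% L) (shiftDown-vanish m p m≤p)

  n<L^n : ∀ n → n < L ^ n
  n<L^n zero    = s≤s z≤n
  n<L^n (suc n) = ≤-trans (s≤s (n<L^n n)) (m<m+n (L ^ n) (*-mono-≤ 1≤l (m^n>0 L n)))

  sumBelow-trim : ∀ x d f → (∀ j → x ≤ j → f j ≡ 0) → sumBelow (x * L + d) f ≡ sumBelow (suc x) f
  sumBelow-trim x d f vanish =
    trans (sumBelow-vanishing x f vanish (x * L + d) (≤-trans (m≤m*n x L) (m≤m+n _ d)))
          (sym (sumBelow-vanishing x f vanish (suc x) (n≤1+n x)))

  digits-value : ∀ N x → x < L ^ N → sumBelow N (λ j → digit L x j * L ^ j) ≡ x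
  digits-value zero    zero    _         = refl
  digits-value zero    (suc x) (s≤s ())
  digits-value (suc N) x       x<L^[1+N] = begin
    sumBelow (suc N) (λ j → digit L x j * L ^ j)
      ≡⟨ sumBelow-shift N _ ⟩
    x % L * 1 + sumBelow N (λ j → digit L x (suc j) * (L * L ^ j))
      ≡⟨ cong₂ _+_ (*-identityʳ _) (sumBelow-cong N (λ j _ → shift j)) ⟩
    x % L + sumBelow N (λ j → L * (digit L (x / L) j * L ^ j))
      ≡⟨ cong (x % L +_) (sumBelow-*ˡ N L _) ⟩
    x % L + L * sumBelow N (λ j → digit L (x / L) j * L ^ j)
      ≡⟨ cong (λ y → x % L + L * y) (digits-value N (x / L) (m<n*o⇒m/o<n (subst (x <_) (*-comm L (L ^ N)) x<L^[1+N]))) ⟩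
    x % L + L * (x / L)
      ≡⟨ trans (cong (x % L +_) (*-comm L (x / L))) (sym (m≡m%n+[m/n]*n x L)) ⟩
    x ∎
    where
    open ≡-Reasoning
    shift : ∀ j → digit L x (suc j) * (L * L ^ j) ≡ L * (digit L (x / L) j * L ^ j)
    shift j = trans (cong (_* (L * L ^ j)) (digit-suc x j)) (m*[n*o]≡n*[m*o] (digit L (x / L) j) L (L ^ j))

  digitSum : ℕ → ℕ
  digitSum x = sumBelow (suc x) (digit L x)

  digitSum-append : ∀ x d → d < L → digitSum (x * L + d) ≡ d + digitSum x
  digitSum-append x d d<L = begin
    digitSum (x * L + d)
      ≡⟨ sumBelow-shift (x * L + d) _ ⟩
    digit L (x * L + d) 0 + sumBelow (x * L + d) (λ j → digit L (x * L + d) (suc j))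
      ≡⟨ cong₂ _+_ (digit-append-zero x d d<L) (sumBelow-cong (x * L + d) (λ j _ → digit-append-suc x d d<L j)) ⟩
    d + sumBelow (x * L + d) (digit L x)
      ≡⟨ cong (d +_) (sumBelow-trim x d (digit L x) (digit-vanish x)) ⟩
    d + digitSum x ∎
    where open ≡-Reasoning

  higher : ℕ → ℕ → ℕ
  higher m j = higherDigitSum L m (suc m) j

  higher-append-suc : ∀ x d → d < L → ∀ j → higher (x * L + d) (suc j) ≡ higher x j
  higher-append-suc x d d<L j = begin
    higher (x * L + d) (suc j)
      ≡⟨ sumBelow-shift (x * L + d) _ ⟩
    sumBelow (x * L + d) (λ p → if j <ᵇ p then digit L (x * L + d) (suc p) else 0)
      ≡⟨ sumBelow-cong (x * L + d) (λ p _ → cong (λ y → if j <ᵇ p then y else 0) (digit-append-suc x d d<L p)) ⟩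
    sumBelow (x * L + d) (λ p → if j <ᵇ p then digit L x p else 0)
      ≡⟨ sumBelow-trim x d _ vanish ⟩
    higher x j ∎
    where
    open ≡-Reasoning
    vanish : ∀ p → x ≤ p → (if j <ᵇ p then digit L x p else 0) ≡ 0
    vanish p x≤p with j <ᵇ p
    ... | true  = digit-vanish x p x≤p
    ... | false = refl

  higher-append-zero : ∀ x d → d < L → higher (x * L + d) 0 ≡ digitSum x
  higher-append-zero x d d<L = begin
    higher (x * L + d) 0
      ≡⟨ sumBelow-shift (x * L + d) _ ⟩
    sumBelow (x * L + d) (λ p → digit L (x * L + d) (suc p))
      ≡⟨ sumBelow-cong (x * L + d) (λ p _ → digit-append-suc x d d<L p) ⟩
    sumBelow (x * L + d) (digit L x)
      ≡⟨ sumBelow-trim x d _ (digit-vanish x) ⟩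
    digitSum x ∎
    where open ≡-Reasoning

  -- definitionally the summand in the definition of ex
  exTerm : ℕ → ℕ → ℕ
  exTerm m j = (L ∸ 1) * digit L m j * j * L ^ j
             + (digit L m j ∸ 1) * digit L m j * L ^ j
             + 2 * (digit L m j * higher m j * L ^ j)

  exTerm-vanish : ∀ x j → x ≤ j → exTerm x j ≡ 0
  exTerm-vanish x j x≤j rewrite digit-vanish x j x≤j | *-zeroʳ l = refl

  exTerm-append-zero : ∀ x d → d < L → exTerm (x * L + d) 0 ≡ (d ∸ 1) * d + 2 * (d * digitSum x)
  exTerm-append-zero x d d<L
    rewrite digit-append-zero x d d<L | higher-append-zero x d d<L = normalise l d (d ∸ 1) (digitSum x)
    where
    normalise : ∀ l d e s → l * d * 0 * 1 + e * d * 1 + 2 * (d * s * 1) ≡ e * d + 2 * (d * s)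
    normalise = solve-∀

  exTerm-append-suc : ∀ x d → d < L → ∀ j →
    exTerm (x * L + d) (suc j) ≡ L * exTerm x j + l * L * (digit L x j * L ^ j)
  exTerm-append-suc x d d<L j
    rewrite digit-append-suc x d d<L j | higher-append-suc x d d<L j =
    normalise l (digit L x j) (digit L x j ∸ 1) j (L ^ j) (higher x j)
    where
    normalise : ∀ l a e j P h →
      l * a * suc j * (suc l * P) + e * a * (suc l * P) + 2 * (a * h * (suc l * P))
        ≡ suc l * (l * a * j * P + e * a * P + 2 * (a * h * P)) + l * suc l * (a * P)
    normalise = solve-∀

  ex-append : ∀ x d → d < L →
    ex L (x * L + d) ≡ (d ∸ 1) * d + 2 * (d * digitSum x) + (L * ex L x + l * L * x)
  ex-append x d d<L = begin
    sumBelow (suc m) (exTerm m)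
      ≡⟨ sumBelow-shift m (exTerm m) ⟩
    exTerm m 0 + sumBelow m (λ j → exTerm m (suc j))
      ≡⟨ cong₂ _+_ (exTerm-append-zero x d d<L) (sumBelow-cong m (λ j _ → exTerm-append-suc x d d<L j)) ⟩
    low + sumBelow m (λ j → L * exTerm x j + l * L * (digit L x j * L ^ j))
      ≡⟨ cong (low +_) (trans (sumBelow-distrib-+ m _ _) (cong₂ _+_ (sumBelow-*ˡ m L _) (sumBelow-*ˡ m (l * L) _))) ⟩
    low + (L * sumBelow m (exTerm x) + l * L * sumBelow m (λ j → digit L x j * L ^ j))
      ≡⟨ cong (λ y → low + (L * y + l * L * sumBelow m (λ j → digit L x j * L ^ j))) (sumBelow-trim x d _ (exTerm-vanish x)) ⟩
    low + (L * ex L x + l * L * sumBelow m (λ j → digit L x j * L ^ j))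
      ≡⟨ cong (λ y → low + (L * ex L x + l * L * y)) value ⟩
    low + (L * ex L x + l * L * x) ∎
    where
    open ≡-Reasoning
    m : ℕ
    m = x * L + d
    low : ℕ
    low = (d ∸ 1) * d + 2 * (d * digitSum x)
    value : sumBelow m (λ j → digit L x j * L ^ j) ≡ x
    value = trans (sumBelow-trim x d _ (λ j x≤j → cong (_* L ^ j) (digit-vanish x j x≤j)))
                  (digits-value (suc x) x (<-≤-trans (n<L^n x) (^-monoʳ-≤ L (n≤1+n x))))

  ex-zero : ex L 0 ≡ 0
  ex-zero = exTerm-vanish 0 0 z≤n

  digitSum-zero : digitSum 0 ≡ 0
  digitSum-zero = digit-vanish 0 0 z≤n

  splitLowDigit : ∀ b r → r < L ^ suc b → QuotRem L (L ^ b) r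
  splitLowDigit b r r<L^[1+b] = quotRem? L (L ^ b) r (subst (r <_) (*-comm L (L ^ b)) r<L^[1+b])

  leading-append : ∀ q b r d → q * L ^ suc b + (r * L + d) ≡ (q * L ^ b + r) * L + d
  leading-append q b r d = reassoc q (L ^ b) r d L
    where
    reassoc : ∀ q P r d L → q * (L * P) + (r * L + d) ≡ (q * P + r) * L + d
    reassoc = solve-∀

  digitSum-leading : ∀ b q r → q < L → r < L ^ b → digitSum (q * L ^ b + r) ≡ q + digitSum r
  digitSum-leading zero q zero q<L _ = begin
    digitSum (q * 1 + 0) ≡⟨ cong digitSum (trans (+-identityʳ _) (*-identityʳ q)) ⟩
    digitSum (0 * L + q) ≡⟨ digitSum-append 0 q q<L ⟩
    q + digitSum 0       ∎
    where open ≡-Reasoning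
  digitSum-leading zero q (suc r) q<L (s≤s ())
  digitSum-leading (suc b) q r q<L r<L^[1+b] with splitLowDigit b r r<L^[1+b]
  ... | quotRem r d r<L^b d<L = begin
    digitSum (q * L ^ suc b + (r * L + d)) ≡⟨ cong digitSum (leading-append q b r d) ⟩
    digitSum ((q * L ^ b + r) * L + d)     ≡⟨ digitSum-append (q * L ^ b + r) d d<L ⟩
    d + digitSum (q * L ^ b + r)           ≡⟨ cong (d +_) (digitSum-leading b q r q<L r<L^b) ⟩
    d + (q + digitSum r)                   ≡⟨ m+[n+o]≡n+[m+o] d q (digitSum r) ⟩
    q + (d + digitSum r)                   ≡⟨ cong (q +_) (sym (digitSum-append r d d<L)) ⟩
    q + digitSum (r * L + d)               ∎
    where open ≡-Reasoning

  ex-leading : ∀ b q r → q < L → r < L ^ b →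
    ex L (q * L ^ b + r) ≡ l * q * b * L ^ b + (q ∸ 1) * q * L ^ b + 2 * q * r + ex L r
  ex-leading zero q zero q<L _ = begin
    ex L (q * 1 + 0)
      ≡⟨ cong (ex L) (trans (+-identityʳ _) (*-identityʳ q)) ⟩
    ex L (0 * L + q)
      ≡⟨ ex-append 0 q q<L ⟩
    (q ∸ 1) * q + 2 * (q * digitSum 0) + (L * ex L 0 + l * L * 0)
      ≡⟨ cong₂ (λ s e → (q ∸ 1) * q + 2 * (q * s) + (L * e + l * L * 0)) digitSum-zero ex-zero ⟩
    (q ∸ 1) * q + 2 * (q * 0) + (L * 0 + l * L * 0)
      ≡⟨ normalise l q (q ∸ 1) ⟩
    l * q * 0 * 1 + (q ∸ 1) * q * 1 + 2 * q * 0 + 0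
      ≡⟨ cong (l * q * 0 * 1 + (q ∸ 1) * q * 1 + 2 * q * 0 +_) (sym ex-zero) ⟩
    l * q * 0 * 1 + (q ∸ 1) * q * 1 + 2 * q * 0 + ex L 0 ∎
    where
    open ≡-Reasoning
    normalise : ∀ l q e → e * q + 2 * (q * 0) + (suc l * 0 + l * suc l * 0) ≡ l * q * 0 * 1 + e * q * 1 + 2 * q * 0 + 0
    normalise = solve-∀
  ex-leading zero q (suc r) q<L (s≤s ())
  ex-leading (suc b) q r q<L r<L^[1+b] with splitLowDigit b r r<L^[1+b]
  ... | quotRem r d r<L^b d<L = begin
    ex L (q * L ^ suc b + (r * L + d))
      ≡⟨ cong (ex L) (leading-append q b r d) ⟩
    ex L ((q * L ^ b + r) * L + d)
      ≡⟨ ex-append (q * L ^ b + r) d d<L ⟩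
    (d ∸ 1) * d + 2 * (d * digitSum (q * L ^ b + r)) + (L * ex L (q * L ^ b + r) + l * L * (q * L ^ b + r))
      ≡⟨ cong₂ (λ s e → (d ∸ 1) * d + 2 * (d * s) + (L * e + l * L * (q * L ^ b + r)))
               (digitSum-leading b q r q<L r<L^b) (ex-leading b q r q<L r<L^b) ⟩
    (d ∸ 1) * d + 2 * (d * (q + digitSum r))
      + (L * (l * q * b * L ^ b + (q ∸ 1) * q * L ^ b + 2 * q * r + ex L r) + l * L * (q * L ^ b + r))
      ≡⟨ normalise l q b (L ^ b) r d (d ∸ 1) (q ∸ 1) (digitSum r) (ex L r) ⟩
    l * q * suc b * L ^ suc b + (q ∸ 1) * q * L ^ suc b + 2 * q * (r * L + d)
      + ((d ∸ 1) * d + 2 * (d * digitSum r) + (L * ex L r + l * L * r))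
      ≡⟨ cong (l * q * suc b * L ^ suc b + (q ∸ 1) * q * L ^ suc b + 2 * q * (r * L + d) +_) (sym (ex-append r d d<L)) ⟩
    l * q * suc b * L ^ suc b + (q ∸ 1) * q * L ^ suc b + 2 * q * (r * L + d) + ex L (r * L + d) ∎
    where
    open ≡-Reasoning
    normalise : ∀ l q b P r d e f s X →
      e * d + 2 * (d * (q + s)) + (suc l * (l * q * b * P + f * q * P + 2 * q * r + X) + l * suc l * (q * P + r))
        ≡ l * q * suc b * (suc l * P) + f * q * (suc l * P) + 2 * q * (r * suc l + d)
          + (e * d + 2 * (d * s) + (suc l * X + l * suc l * r))
    normalise = solve-∀

  ex-single : ∀ t g → g < L → ex L (g * L ^ t) ≡ l * g * t * L ^ t + (g ∸ 1) * g * L ^ t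
  ex-single t g g<L = begin
    ex L (g * L ^ t)
      ≡⟨ cong (ex L) (sym (+-identityʳ (g * L ^ t))) ⟩
    ex L (g * L ^ t + 0)
      ≡⟨ ex-leading t g 0 g<L (m^n>0 L t) ⟩
    l * g * t * L ^ t + (g ∸ 1) * g * L ^ t + 2 * g * 0 + ex L 0
      ≡⟨ cong₂ (λ z e → l * g * t * L ^ t + (g ∸ 1) * g * L ^ t + z + e) (*-zeroʳ (2 * g)) ex-zero ⟩
    l * g * t * L ^ t + (g ∸ 1) * g * L ^ t + 0 + 0
      ≡⟨ trans (+-identityʳ _) (+-identityʳ _) ⟩
    l * g * t * L ^ t + (g ∸ 1) * g * L ^ t ∎
    where open ≡-Reasoning

  ex≤ : ∀ n m → m < L ^ n → ex L m ≤ l * n * m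
  ex≤ zero    zero    _  = ≤-trans (≤-reflexive ex-zero) (z≤n {l * 0 * 0})
  ex≤ zero    (suc m) (s≤s ())
  ex≤ (suc k) m m<L^[1+k] with quotRem? (L ^ k) L m {{m^n≢0 L k}} m<L^[1+k]
  ... | quotRem q r q<L r<L^k = begin
    ex L (q * L ^ k + r)        ≡⟨ ex-leading k q r q<L r<L^k ⟩
    cost + ex L r               ≤⟨ +-monoʳ-≤ cost (ex≤ k r r<L^k) ⟩
    cost + l * k * r            ≤⟨ ex≤-arith l k q (L ^ k) r (≤-pred q<L) (<⇒≤ r<L^k) ⟩
    l * suc k * (q * L ^ k + r) ∎
    where
    open ≤-Reasoning
    cost : ℕ
    cost = l * q * k * L ^ k + (q ∸ 1) * q * L ^ k + 2 * q * r

  -- ξ_{j+1+s}(q L^j) = L^j * gain s q (ξ-single). Statements about ξ_n x = l n x - ex x are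
  -- kept additive, e.g. ξ a ≤ ξ m as l n a + ex m ≤ ex a + l n m, to avoid truncated subtraction.
  gain : ℕ → ℕ → ℕ
  gain s q = q * (l * s + L ∸ q)

  ξ-single : ∀ s t g → g < L → ex L (g * L ^ t) + L ^ t * gain s g ≡ l * suc (s + t) * (g * L ^ t)
  ξ-single s t g g<L =
    trans (cong (_+ L ^ t * gain s g) (ex-single t g g<L)) (ξ-single-arith l s t g (L ^ t) (<⇒≤ g<L))

  ξ-leading-≥ : ∀ s j q r → q ≤ l → r < L ^ j → 2 * q * r ≤ l * suc s * r →
    L ^ j * gain s q + ex L (q * L ^ j + r) ≤ l * suc (s + j) * (q * L ^ j + r)
  ξ-leading-≥ s j q r q≤l r<L^j 2qr≤ =
    subst (λ x → L ^ j * gain s q + x ≤ l * suc (s + j) * (q * L ^ j + r)) (sym (ex-leading j q r (s≤s q≤l) r<L^j))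
      (ξ-leading-≥-arith l s j q (L ^ j) r (ex L r) q≤l (ex≤ j r r<L^j) 2qr≤)

  ξ-single-≤-top : ∀ t j g → t < j → g ≤ l → l * suc j * (g * L ^ t) ≤ ex L (g * L ^ t) + l * L ^ j
  ξ-single-≤-top t (suc j) g (s≤s t≤j) g≤l with m≤n⇒m<n∨m≡n t≤j
  ... | inj₂ refl = begin
    l * suc (suc t) * (g * L ^ t)   ≡⟨ sym (ξ-single 1 t g (s≤s g≤l)) ⟩
    ex L (g * L ^ t) + L ^ t * gain 1 g
      ≤⟨ +-monoʳ-≤ (ex L (g * L ^ t)) (*-monoʳ-≤ (L ^ t) (m*[n∸m]-mono (l * 1 + L) g l g≤l l+l≤)) ⟩
    ex L (g * L ^ t) + L ^ t * gain 1 l ≡⟨ cong (ex L (g * L ^ t) +_) top ⟩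
    ex L (g * L ^ t) + l * L ^ suc t ∎
    where
    open ≤-Reasoning
    l+l≤ : l + l ≤ l * 1 + L
    l+l≤ = +-mono-≤ (≤-reflexive (sym (*-identityʳ l))) (n≤1+n l)
    top : L ^ t * gain 1 l ≡ l * L ^ suc t
    top = begin-equality
      L ^ t * (l * (l * 1 + L ∸ l)) ≡⟨ cong (λ x → L ^ t * (l * (x + L ∸ l))) (*-identityʳ l) ⟩
      L ^ t * (l * (l + L ∸ l))     ≡⟨ cong (λ x → L ^ t * (l * x)) (m+n∸m≡n l L) ⟩
      L ^ t * (l * L)               ≡⟨ m*[n*o]≡n*[m*o] (L ^ t) l L ⟩
      l * (L ^ t * L)               ≡⟨ cong (l *_) (*-comm (L ^ t) L) ⟩
      l * L ^ suc t                 ∎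
  ... | inj₁ t<j = subst (λ x → l * suc (suc j) * (g * L ^ t) ≤ ex L (g * L ^ t) + x) (grow l (L ^ j))
    (factor-step-≤ l j (g * L ^ t) (ex L (g * L ^ t)) (l * L ^ j) (l * L ^ j)
      (ξ-single-≤-top t j g t<j g≤l)
      (*-mono-≤ g≤l (^-monoʳ-≤ L (<⇒≤ t<j))))
    where
    grow : ∀ l P → l * P + l * (l * P) ≡ l * (suc l * P)
    grow = solve-∀

  ξ-single-≤ : ∀ s t j g → t < j → g ≤ l → l * suc (s + j) * (g * L ^ t) ≤ ex L (g * L ^ t) + l * suc s * L ^ j
  ξ-single-≤ zero t j g t<j g≤l =
    subst (λ x → l * suc j * (g * L ^ t) ≤ ex L (g * L ^ t) + x * L ^ j) (sym (*-identityʳ l))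
      (ξ-single-≤-top t j g t<j g≤l)
  ξ-single-≤ (suc s) t j g t<j g≤l =
    subst (λ x → l * suc (suc (s + j)) * (g * L ^ t) ≤ ex L (g * L ^ t) + x) (grow l s (L ^ j))
      (factor-step-≤ l (s + j) (g * L ^ t) (ex L (g * L ^ t)) (l * suc s * L ^ j) (L ^ j)
        (ξ-single-≤ s t j g t<j g≤l)
        (≤-trans (*-monoˡ-≤ (L ^ t) (m≤n⇒m≤1+n g≤l)) (^-monoʳ-≤ L t<j)))
    where
    grow : ∀ l s P → l * suc s * P + l * P ≡ l * suc (suc s) * P
    grow = solve-∀

  data LeadingDigit : ℕ → ℕ → Set where
    leadingDigit : ∀ s j q r → 1 ≤ q → q < L → r < L ^ j → LeadingDigit (s + j) (q * L ^ j + r)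

  leadingDigit? : ∀ k m → 1 ≤ m → m < L ^ suc k → LeadingDigit k m
  leadingDigit? k m 1≤m m<L^[1+k] with quotRem? (L ^ k) L m {{m^n≢0 L k}} m<L^[1+k]
  leadingDigit? k       _ _   _ | quotRem (suc p) r q<L r<L^k = leadingDigit 0 k (suc p) r (s≤s z≤n) q<L r<L^k
  leadingDigit? zero    _ ()  _ | quotRem zero zero    _ _
  leadingDigit? zero    _ _   _ | quotRem zero (suc r) _ (s≤s ())
  leadingDigit? (suc k) _ 1≤r _ | quotRem zero r       _ r<L^[1+k] with leadingDigit? k r 1≤r r<L^[1+k]
  ... | leadingDigit s j q r′ 1≤q q<L r′<L^j = leadingDigit (suc s) j q r′ 1≤q q<L r′<L^j

  leading-<-next : ∀ j q r → r < L ^ j → q * L ^ j + r < suc q * L ^ j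
  leading-<-next j q r r<L^j = <-≤-trans (+-monoʳ-< (q * L ^ j) r<L^j) (≤-reflexive (+-comm (q * L ^ j) (L ^ j)))

  leading-< : ∀ j q r → q < L → r < L ^ j → q * L ^ j + r < L ^ suc j
  leading-< j q r q<L r<L^j = <-≤-trans (leading-<-next j q r r<L^j) (*-monoˡ-≤ (L ^ j) q<L)

  leading-≥ : ∀ j g q r → g * L ^ j ≤ q * L ^ j + r → r < L ^ j → g ≤ q
  leading-≥ j g q r gM≤ r<L^j = ≤-pred (*-cancelʳ-< (L ^ j) g (suc q) (≤-<-trans gM≤ (leading-<-next j q r r<L^j)))

  L^-cancel-< : ∀ {t n} → L ^ t < L ^ n → t < n
  L^-cancel-< {t} {n} L^t<L^n with t <? n
  ... | yes t<n = t<n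
  ... | no  t≮n = contradiction (<-≤-trans L^t<L^n (^-monoʳ-≤ L (≮⇒≥ t≮n))) (<-irrefl refl)

  leading-below-half : ∀ s j q r → q < L → r < L ^ j → 2 * (q * L ^ j + r) ≤ L ^ suc (s + j) →
    2 * q * r ≤ l * suc s * r × q + q ≤ l * s + L
  leading-below-half (suc s) j q r (s≤s q≤l) _ _ = *-monoˡ-≤ r 2q≤ , q+q≤
    where
    2q≤ : 2 * q ≤ l * suc (suc s)
    2q≤ = ≤-trans (*-monoʳ-≤ 2 q≤l) (≤-trans (≤-reflexive (*-comm 2 l)) (*-monoʳ-≤ l (s≤s (s≤s z≤n))))
    q+q≤ : q + q ≤ l * suc s + L
    q+q≤ = ≤-trans (+-mono-≤ q≤l (m≤n⇒m≤1+n q≤l)) (+-monoˡ-≤ L (m≤m*n l (suc s)))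
  leading-below-half zero j q r q<L r<L^j half = 2qr≤ , subst (λ x → q + q ≤ x + L) (sym (*-zeroʳ l)) q+q≤L
    where
    M : ℕ
    M = L ^ j
    2q≡q+q : 2 * q ≡ q + q
    2q≡q+q = cong (q +_) (+-identityʳ q)
    2[qM]≤ : 2 * (q * M) ≤ L * M
    2[qM]≤ = ≤-trans (*-monoʳ-≤ 2 (m≤m+n (q * M) r)) half
    q+q≤L : q + q ≤ L
    q+q≤L = *-cancelʳ-≤ (q + q) L M {{m^n≢0 L j}}
      (subst (_≤ L * M) (trans (sym (*-assoc 2 q M)) (cong (_* M) 2q≡q+q)) 2[qM]≤)
    r≡0 : L ≤ q + q → r ≡ 0
    r≡0 L≤q+q = n≤0⇒n≡0 (*-cancelˡ-≤ 2 (+-cancelˡ-≤ (2 * (q * M)) _ _ (begin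
      2 * (q * M) + 2 * r ≡⟨ sym (*-distribˡ-+ 2 (q * M) r) ⟩
      2 * (q * M + r)     ≤⟨ half ⟩
      L * M               ≤⟨ *-monoˡ-≤ M L≤q+q ⟩
      (q + q) * M         ≡⟨ trans (cong (_* M) (sym 2q≡q+q)) (*-assoc 2 q M) ⟩
      2 * (q * M)         ≡⟨ sym (+-identityʳ _) ⟩
      2 * (q * M) + 2 * 0 ∎)))
      where open ≤-Reasoning
    2qr≤ : 2 * q * r ≤ l * 1 * r
    2qr≤ with q + q ≤? l
    ... | yes q+q≤l = *-monoˡ-≤ r (subst₂ _≤_ (sym 2q≡q+q) (sym (*-identityʳ l)) q+q≤l)
    ... | no  q+q≰l rewrite r≡0 (≰⇒> q+q≰l) = ≤-reflexive (trans (*-zeroʳ (2 * q)) (sym (*-zeroʳ (l * 1))))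

  gain-≥ : ∀ s q → 1 ≤ q → q < L → l * suc s ≤ gain s q
  gain-≥ s q 1≤q q<L = subst (_≤ gain s q) C∸1≡ (n∸1≤m*[n∸m] (l * s + L) q 1≤q (<-≤-trans q<L (m≤n+m L (l * s))))
    where
    C∸1≡ : l * s + L ∸ 1 ≡ l * suc s
    C∸1≡ = trans (cong (_∸ 1) (+-suc (l * s) l)) (trans (+-comm (l * s) l) (sym (*-suc l s)))

  ξ-single-≤-ξ : ∀ k t g m → 1 ≤ g → g ≤ l → g * L ^ t ≤ m → 2 * m ≤ L ^ suc k →
    l * suc k * (g * L ^ t) + ex L m ≤ ex L (g * L ^ t) + l * suc k * m
  ξ-single-≤-ξ k t g m 1≤g g≤l a≤m 2m≤ with leadingDigit? k m 1≤m (m<n⇐2m≤n 1≤m 2m≤)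
    where
    1≤m : 1 ≤ m
    1≤m = ≤-trans (*-mono-≤ 1≤g (m^n>0 L t)) a≤m
  ... | leadingDigit s j q r 1≤q q<L r<L^j =
    +-exchange-≤ bound-single (ξ-leading-≥ s j q r (≤-pred q<L) r<L^j (proj₁ bal))
    where
    bal : 2 * q * r ≤ l * suc s * r × q + q ≤ l * s + L
    bal = leading-below-half s j q r q<L r<L^j 2m≤
    L^t≤a : L ^ t ≤ g * L ^ t
    L^t≤a = subst (_≤ g * L ^ t) (*-identityˡ (L ^ t)) (*-monoˡ-≤ (L ^ t) 1≤g)
    t≤j : t ≤ j
    t≤j = ≤-pred (L^-cancel-< (≤-<-trans L^t≤a (≤-<-trans a≤m (leading-< j q r q<L r<L^j))))
    bound-single : l * suc (s + j) * (g * L ^ t) ≤ ex L (g * L ^ t) + L ^ j * gain s q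
    bound-single with m≤n⇒m<n∨m≡n t≤j
    ... | inj₁ t<j = ≤-trans (ξ-single-≤ s t j g t<j g≤l)
            (+-monoʳ-≤ (ex L (g * L ^ t)) (subst (_≤ L ^ j * gain s q) (*-comm (L ^ j) (l * suc s)) (*-monoʳ-≤ (L ^ j) (gain-≥ s q 1≤q q<L))))
    ... | inj₂ refl = ≤-trans (≤-reflexive (sym (ξ-single s t g (s≤s g≤l))))
            (+-monoʳ-≤ (ex L (g * L ^ t)) (*-monoʳ-≤ (L ^ t) (m*[n∸m]-mono (l * s + L) g q (leading-≥ t g q r a≤m r<L^j) (proj₂ bal))))

[+a]-[+b]≤[+c]-[+d] : ∀ a b c d → a + d ≤ b + c → ℤ.+ a ℤ.- ℤ.+ b ℤ.≤ ℤ.+ c ℤ.- ℤ.+ d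
[+a]-[+b]≤[+c]-[+d] a b c d a+d≤b+c =
  subst₂ ℤ._≤_ (sym left) (sym right) (ℤ.⊖-monoˡ-≤ (d + b) (subst (a + d ≤_) (+-comm b c) a+d≤b+c))
  where
  left : ℤ.+ a ℤ.- ℤ.+ b ≡ (a + d) ℤ.⊖ (d + b)
  left = trans (ℤ.[+m]-[+n]≡m⊖n a b) (trans (sym (ℤ.+-cancelˡ-⊖ d a b)) (cong (ℤ._⊖ (d + b)) (+-comm d a)))
  right : ℤ.+ c ℤ.- ℤ.+ d ≡ (c + b) ℤ.⊖ (d + b)
  right = trans (ℤ.[+m]-[+n]≡m⊖n c d) (trans (sym (ℤ.+-cancelˡ-⊖ b c d)) (cong₂ ℤ._⊖_ (+-comm b c) (+-comm b d)))

mainTheorem8 : (L n t g : ℕ) → 2 ≤ L → 2 ≤ n → t < n → 1 ≤ g → g < L →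
    (m : ℕ) → g * L ^ t ≤ m → m ≤ (L ^ n) / 2 →
    ξ L n (g * L ^ t) ℤ.≤ ξ L n m
mainTheorem8 (suc l) (suc k) t g (s≤s 1≤l) _ (s≤s _) 1≤g (s≤s g≤l) m a≤m m≤L^n/2 =
  [+a]-[+b]≤[+c]-[+d] (c * a) (ex L a) (c * m) (ex L m)
    (ξ-single-≤-ξ k t g m 1≤g g≤l a≤m (m≤n/2⇒2m≤n m (L ^ suc k) m≤L^n/2))
  where
  open Radix l 1≤l
  a : ℕ
  a = g * L ^ t
  c : ℕ
  c = l * suc k
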